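{- Let $h\ge1$ be an integer and $t(\cdot)$ a polynomial. Fix a nondeterministic oracle Turing machine $N$ with running time bounded by a polynomial $p(\cdot)$, a set $\mathcal{O}\subseteq\{0,1\}^*$, and sets $X=\{x_1,\dots,x_d\}$ and $Y=\{y_1,\dots,y_{d'}\}$ of strings of length at most $m$. Let $U_1,\dots,U_r\subseteq\{0,1\}^*$ be such that for all distinct $\ell,\ell'$, $\mathcal{O}\cap U_\ell=\mathcal{O}\cap U_{\ell'}=U_\ell\cap U_{\ell'}=\emptyset$ and $\|U_\ell\|=\|U_{\ell'}\|\ge u$. Let $\mathcal{L}$ be an $(h,t)$-ambiguous function such that $\mathcal{L}(\mathcal{O}\cup\bigcup_{\ell\in[r]}A_\ell)$ is defined for all $A_\ell\subseteq U_\ell$ with $\|A_\ell\|\le h$. If $u>(3d+d')\cdot r\cdot 2^{2r}\cdot p(m)\cdot t(p(m))$, then there exist strings $\alpha_1\in U_1,\dots,\alpha_r\in U_r$ such that: (A) for every $x\in X$ and every pair of distinct nonempty sets $S_1,S_2\subseteq\{1,\dots,r\}$, if (A.1) $N^{\mathcal{L}(\mathcal{O}\cup\{\alpha_\ell:\ell\in S_1\})}(x)$ accepts and for every proper subset $S_1'\subsetneq S_1$, $N^{\mathcal{L}(\mathcal{O}\cup\{\alpha_\ell:\ell\in S_1'\})}(x)$ rejects, and (A.2) the same holds for $S_2$ in place of $S_1$, then $N^{\mathcal{L}(\mathcal{O}\cup\{\alpha_\ell:\ell\in S_1\cup S_2\})}(x)$ has at least two accepting paths; (B) for every $y\in Y$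 and every nonempty $S\subseteq\{1,\dots,r\}$, if $N^{\mathcal{L}(\mathcal{O})}(y)$ accepts then $N^{\mathcal{L}(\mathcal{O}\cup\{\alpha_\ell:\ell\in S\})}(y)$ also accepts.
   Context: $[r]=\{1,\dots,r\}$, $\mathcal{P}(S)$ is the power set, $\|S\|$ the cardinality. For $h\in\mathbb{N}^+$ and a polynomial $t$, a partial or total function $\mathcal{L}:\mathcal{P}(\{0,1\}^*)\to\mathcal{P}(\{0,1\}^*)$ is $(h,t)$-ambiguous if for all $\mathcal{O},U\subseteq\{0,1\}^*$ with $\mathcal{O}\cap U=\emptyset$, either (1) for some $A\subseteq U$ with $\|A\|\le h$, $\mathcal{L}(\mathcal{O}\cup A)$ is undefined, or (2) for every string $w$, $\|\{\alpha\in U: w\in\mathcal{L}(\mathcal{O}\cup\{\alpha\})\iff w\notin\mathcal{L}(\mathcal{O})\}\|\le t(|w|)$. $N^{S}(x)$ denotes the computation of $N$ on $x$ with oracle $S$. -}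

module Defs where

open import Data.Bool using (Bool; true; false; _∨_)
import Data.Bool as B
open import Data.Nat using (ℕ; zero; suc; _+_; _*_; _^_; _≤_; _<_; _⊔_)
open import Data.Fin using (Fin)
open import Data.Fin.Subset using (Subset; _∈_; _⊂_; _∪_; Nonempty)
open import Data.Fin.Subset.Properties using (_∈?_)
open import Data.List using (List; []; _∷_; length; map; filter; concat; allFin)
open import Data.Bool.ListAction using (any)
open import Data.List.Properties using (≡-dec)
open import Data.List.Relation.Unary.All using (All)
open import Data.List.Relation.Unary.Unique.Propositional using (Unique)
import Data.List.Membership.Propositional as LM
open import Data.Maybe using (Maybe; just; nothing; Is-just)
open import Data.Maybe.Relation.Unary.Any using (Any)
open import Data.Maybe.Relation.Binary.Pointwise using (Pointwise)
open import Data.Product using (_×_; ∃)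
open import Relation.Binary.PropositionalEquality using (_≡_; _≢_)
open import Relation.Nullary.Decidable using (isYes; Dec)

-- Strings over {0,1}, and sets of strings (given by characteristic
-- functions, as oracles must answer membership queries).

String : Set
String = List Bool

_≟s_ : (v w : String) → Dec (v ≡ w)
_≟s_ = ≡-dec B._≟_

StrSet : Set
StrSet = String → Bool

_∈ᵇ_ : String → List String → Bool
w ∈ᵇ A = any (λ v → isYes (w ≟s v)) A

_∪L_ : StrSet → List String → StrSet
(S ∪L A) w = S w ∨ (w ∈ᵇ A)

_∈L_ : String → List String → Set
w ∈L A = w LM.∈ A

-- Polynomials with natural coefficients: coefficient list, lowest degree first.

Poly : Set
Poly = List ℕ

eval : Poly → ℕ → ℕ
eval []       n = 0
eval (c ∷ cs) n = c + n * eval cs n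

-- Partial functions P({0,1}*) → P({0,1}*): a Maybe-valued function on
-- sets which is a function of the *set* (respects extensional equality).

_≐_ : StrSet → StrSet → Set
S ≐ T = ∀ w → S w ≡ T w

record SetFun : Set where
  field
    app : StrSet → Maybe StrSet
    ext : ∀ {S T} → S ≐ T → Pointwise _≐_ (app S) (app T)
open SetFun public

-- Clause (1) "L(O ∪ A) undefined for some A ⊆ U with
-- ‖A‖ ≤ h" is stated in its classically equivalent contrapositive form:
-- if L(O ∪ A) is defined for all such A, then clause (2) holds.
-- A set {α ∈ U : ...} has cardinality ≤ t(|w|) iff every duplicate-free
-- list of its elements has length ≤ t(|w|).

Flips : SetFun → StrSet → String → String → Set
Flips L O α w =
  Any (λ Bα → Any (λ BO → Bα w ≢ BO w) (app L O)) (app L (O ∪L (α ∷ [])))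

Ambiguous : ℕ → Poly → SetFun → Set
Ambiguous h t L =
  ∀ (O U : StrSet) → (∀ w → O w ≡ true → U w ≡ false) →
  (∀ (A : List String) → All (λ a → U a ≡ true) A → length A ≤ h →
     Is-just (app L (O ∪L A))) →
  ∀ (w : String) (αs : List String) → Unique αs →
  All (λ α → U α ≡ true × Flips L O α w) αs →
  length αs ≤ eval t (length w)

-- Nondeterministic oracle machines, modelled by their computation trees.
-- accept / reject: halting configurations;
-- branch: a binary nondeterministic choice (one step);
-- query w yes no: query string w to the oracle, continue with `yes` if
--   w is in the oracle and with `no` otherwise (costs |w|+1 steps, the
--   time needed to write w on the query tape).

data Tree : Set where
  accept reject : Tree
  branch        : Tree → Tree → Tree
  query         : String → Tree → Tree → Tree

time : Tree → ℕ
time accept        = 0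
time reject        = 0
time (branch l r)  = suc (time l ⊔ time r)
time (query w y n) = suc (length w) + (time y ⊔ time n)

#acc : StrSet → Tree → ℕ
#acc A accept        = 1
#acc A reject        = 0
#acc A (branch l r)  = #acc A l + #acc A r
#acc A (query w y n) with A w
... | true  = #acc A y
... | false = #acc A n

record NOTM (p : Poly) : Set where
  field
    run   : String → Tree
    timed : ∀ x → time (run x) ≤ eval p (length x)
open NOTM public

Accepts : ∀ {p} → NOTM p → StrSet → String → Set
Accepts N A x = 1 ≤ #acc A (run N x)

Rejects : ∀ {p} → NOTM p → StrSet → String → Set
Rejects N A x = #acc A (run N x) ≡ 0

pick : ∀ {r} → (Fin r → String) → Subset r → List String
pick {r} α S = map α (filter (λ ℓ → ℓ ∈? S) (allFin r))

⋃L : ∀ {r} → (Fin r → List String) → List String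
⋃L {r} A = concat (map A (allFin r))

AccWith : ∀ {p} → SetFun → NOTM p → StrSet → ∀ {r} → (Fin r → String) → Subset r → String → Set
AccWith L N O α S x = Any (λ B → Accepts N B x) (app L (O ∪L pick α S))

RejWith : ∀ {p} → SetFun → NOTM p → StrSet → ∀ {r} → (Fin r → String) → Subset r → String → Set
RejWith L N O α S x = Any (λ B → Rejects N B x) (app L (O ∪L pick α S))

MinimalAcc : ∀ {p} → SetFun → NOTM p → StrSet → ∀ {r} → (Fin r → String) → Subset r → String → Set
MinimalAcc L N O {r} α S x =
  AccWith L N O α S x × (∀ (S' : Subset r) → S' ⊂ S → RejWith L N O α S' x)

{-# OPTIONS --safe #-}
module Submission where

-- Call α ∈ U₁ × ⋯ × U_r flip-free if for every input z ∈ X ∪ Y, all S, R ⊆ [r] and every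
-- ℓ ∉ S ∪ R, adding α_ℓ to O ∪ α(R) changes the answer of L on none of the queries made on
-- the leftmost accepting path of N^{L(O ∪ α(S))}(z).  Neither those queries nor O ∪ α(R)
-- depend on α_ℓ, so by (h,t)-ambiguity every line of the box in direction ℓ carries at most
-- p(m)·t(p(m)) flips per (z, S, R).  Averaging over the box, the expected number of flips is
-- at most r·(d + d′)·4^r·p(m)·t(p(m))/u < 1, so a flip-free α exists.
--
-- For a flip-free α, enlarging R to T ⊇ R by indices outside S, one at a time, never changes
-- the answers along the path for S.  Hence an accepting path for ∅ stays accepting for every S
-- (B), and the leftmost accepting paths for minimal S₁ ≠ S₂ both stay accepting for S₁ ∪ S₂.
-- They are distinct, since a common path would also accept with S₁ ∩ S₂, a proper subset of
-- S₁ (A).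

open import Defs
open import Data.Bool using (true; false; _∨_)
import Data.Bool as Bool
open import Data.Bool.Properties using (∨-assoc; ∨-identityʳ; ⇔→≡)
open import Data.Empty using (⊥)
open import Data.Fin using (Fin; zero; suc; _≟_)
open import Data.Fin.Subset
  using (Subset; inside; outside; _∪_; _∩_; ⁅_⁆; _⊆_; _⊂_; _⊈_; Nonempty)
  renaming (_∈_ to _∈ₛ_; _∉_ to _∉ₛ_; ⊥ to ∅)
open import Data.Fin.Subset.Properties
  using ( _∈?_; _⊂?_; ⊆-antisym; ∉⊥; ⊥⊆; x∈p∩q⁺; p∩q⊆p; p∩q⊆q; p⊆p∪q; q⊆p∪q; x∈p∪q⁻
        ; x∈⁅x⁆; x∈⁅y⁆⇒x≡y )
open import Data.List using (List; []; _∷_; length; map; filter; allFin; _++_)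
open import Data.List.Membership.Propositional using (_∈_; _∉_)
open import Data.List.Membership.Propositional.Properties
  using ( ∈-map⁺; ∈-map⁻; ∈-filter⁺; ∈-filter⁻; ∈-allFin; ∈-++⁺ˡ; ∈-++⁺ʳ; ∈-++⁻
        ; ∈-concat⁺′; ∈-concat⁻′ )
open import Data.List.Properties using (length-++; length-map; length-tabulate; length-filter; map-cong-local)
open import Data.List.Relation.Unary.All as All using (All; []; _∷_)
import Data.List.Relation.Unary.All.Properties as All
open import Data.List.Relation.Unary.Any using (here; there)
open import Data.List.Relation.Unary.Unique.Propositional using (Unique)
import Data.List.Relation.Unary.Unique.Propositional.Properties as Unique
open import Data.Maybe using (Maybe; just; nothing; Is-just; to-witness; maybe′)
open import Data.Maybe.Relation.Binary.Pointwise using (Pointwise; just)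
open import Data.Maybe.Relation.Unary.Any as MaybeAny using (Any; just)
open import Data.Nat using (ℕ; zero; suc; _+_; _*_; _^_; _≤_; _<_; z≤n; s≤s)
open import Data.Nat.Properties
  using ( ≤-refl; ≤-reflexive; ≤-trans; <⇒≤; ≤-<-trans; <-≤-trans; _<?_; ≮⇒≥; module ≤-Reasoning
        ; +-identityʳ; +-mono-≤; +-monoˡ-≤; +-monoʳ-≤; +-cancelˡ-<; m≤m+n; m≤n+m; m+n≡0⇒m≡0; m+n≡0⇒n≡0
        ; *-identityˡ; *-identityʳ; *-zeroʳ; *-assoc; *-distribˡ-+; *-mono-≤; *-monoˡ-≤; *-monoʳ-≤
        ; *-monoˡ-<; *-cancelˡ-<; ^-distribˡ-+-*; m^n≢0; n<1⇒n≡0; m≤n⇒m≤1+n; m≤m⊔n; m≤n⊔m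
        ; +-commutativeSemigroup; *-commutativeSemigroup )
open import Algebra.Properties.CommutativeSemigroup +-commutativeSemigroup using (interchange)
open import Algebra.Properties.CommutativeSemigroup *-commutativeSemigroup using (x∙yz≈y∙xz)
open import Data.Nat.Tactic.RingSolver using (solve-∀)
open import Data.Product as Product using (_×_; Σ; ∃; _,_; proj₁; proj₂)
open import Data.Sum as Sum using (_⊎_; inj₁; inj₂; [_,_]′)
open import Data.Unit using (⊤; tt)
open import Data.Vec using ([]; _∷_)
open import Data.Vec.Functional using (Vector; head; tail) renaming (_∷_ to _∷ᵛ_; [] to []ᵛ)
open import Function using (_∘_; id)
open import Function.Bundles using (_⇔_; mk⇔; module Equivalence)
open Equivalence using (to; from)
open import Relation.Binary.PropositionalEquality
  using (_≡_; _≢_; refl; sym; trans; cong; cong₂; subst; module ≡-Reasoning)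
open import Relation.Nullary using (¬_; Dec; yes; no; ¬?; _×-dec_; contradiction)
open import Relation.Nullary.Decidable using (decidable-stable; isYes)
open import Relation.Unary using (Pred; Decidable)

private
  variable
    A C : Set
    r : ℕ

∑ : List A → (A → ℕ) → ℕ
∑ []       f = 0
∑ (a ∷ as) f = f a + ∑ as f

infix 5 ∑
syntax ∑ xs (λ a → e) = ∑[ a ← xs ] e

module _ {f g : A → ℕ} where

  ∑-cong : ∀ xs → (∀ {a} → a ∈ xs → f a ≡ g a) → ∑ xs f ≡ ∑ xs g
  ∑-cong []       f≡g = refl
  ∑-cong (a ∷ as) f≡g = cong₂ _+_ (f≡g (here refl)) (∑-cong as (f≡g ∘ there))

  ∑-mono-≤ : ∀ xs → (∀ {a} → a ∈ xs → f a ≤ g a) → ∑ xs f ≤ ∑ xs g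
  ∑-mono-≤ []       f≤g = z≤n
  ∑-mono-≤ (a ∷ as) f≤g = +-mono-≤ (f≤g (here refl)) (∑-mono-≤ as (f≤g ∘ there))

  ∑-distrib-+ : ∀ xs → ∑[ a ← xs ] (f a + g a) ≡ ∑ xs f + ∑ xs g
  ∑-distrib-+ []       = refl
  ∑-distrib-+ (a ∷ as) rewrite ∑-distrib-+ as = interchange (f a) (g a) (∑ as f) (∑ as g)

  ∑<∑⇒∃ : ∀ xs → ∑ xs f < ∑ xs g → ∃ λ a → a ∈ xs × f a < g a
  ∑<∑⇒∃ (a ∷ as) fs<gs with f a <? g a
  ... | yes fa<ga = a , here refl , fa<ga
  ... | no  fa≮ga =
    let b , b∈as , fb<gb = ∑<∑⇒∃ as (+-cancelˡ-< (g a) _ _ (≤-<-trans (+-monoˡ-≤ _ (≮⇒≥ fa≮ga)) fs<gs))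
    in  b , there b∈as , fb<gb

∑-const : ∀ (xs : List A) c → ∑[ _ ← xs ] c ≡ length xs * c
∑-const []       c = refl
∑-const (a ∷ as) c = cong (c +_) (∑-const as c)

∑≤length* : ∀ (xs : List A) {f c} → (∀ {a} → a ∈ xs → f a ≤ c) → ∑ xs f ≤ length xs * c
∑≤length* xs {c = c} f≤c = ≤-trans (∑-mono-≤ xs f≤c) (≤-reflexive (∑-const xs c))

*-distribˡ-∑ : ∀ k (xs : List A) f → k * ∑ xs f ≡ ∑[ a ← xs ] (k * f a)
*-distribˡ-∑ k []       f = *-zeroʳ k
*-distribˡ-∑ k (a ∷ as) f = trans (*-distribˡ-+ k (f a) (∑ as f)) (cong (k * f a +_) (*-distribˡ-∑ k as f))

∑-comm : ∀ (xs : List A) (ys : List C) (f : A → C → ℕ) →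
         ∑[ a ← xs ] ∑[ b ← ys ] f a b ≡ ∑[ b ← ys ] ∑[ a ← xs ] f a b
∑-comm []       ys f = sym (trans (∑-const ys 0) (*-zeroʳ (length ys)))
∑-comm (a ∷ as) ys f =
  trans (cong (∑ ys (f a) +_) (∑-comm as ys f)) (sym (∑-distrib-+ ys))

∑-comm-≤ : ∀ (xs : List A) (ys : List C) {f : A → C → ℕ} {c} → (∀ {b} → b ∈ ys → ∑[ a ← xs ] f a b ≤ c) →
           ∑[ a ← xs ] ∑[ b ← ys ] f a b ≤ length ys * c
∑-comm-≤ xs ys {f} bound = ≤-trans (≤-reflexive (∑-comm xs ys f)) (∑≤length* ys bound)

∑≡0⇒≡0 : ∀ {xs : List A} {f a} → ∑ xs f ≡ 0 → a ∈ xs → f a ≡ 0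
∑≡0⇒≡0 {f = f} {a} ∑≡0 (here refl)   = m+n≡0⇒m≡0 (f a) ∑≡0
∑≡0⇒≡0 {xs = b ∷ _} {f} ∑≡0 (there a∈) = ∑≡0⇒≡0 (m+n≡0⇒n≡0 (f b) ∑≡0) a∈

∑-≤-if-inhabited : ∀ {xs : List A} {f c} → (∀ {a} → a ∈ xs → ∑ xs f ≤ c) → ∑ xs f ≤ c
∑-≤-if-inhabited {xs = []}    _     = z≤n
∑-≤-if-inhabited {xs = _ ∷ _} bound = bound (here refl)

∈⇒≤∑ : ∀ {xs : List A} {f a} → a ∈ xs → f a ≤ ∑ xs f
∈⇒≤∑ {xs = _ ∷ as} {f} (here refl) = m≤m+n _ (∑ as f)
∈⇒≤∑ {xs = b ∷ _}  {f} (there a∈)  = ≤-trans (∈⇒≤∑ a∈) (m≤n+m _ (f b))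

length≤∑suc : ∀ (xs : List A) {f : A → ℕ} → length xs ≤ ∑[ a ← xs ] suc (f a)
length≤∑suc []           = z≤n
length≤∑suc (a ∷ as) {f} = s≤s (≤-trans (length≤∑suc as) (m≤n+m _ (f a)))

⟦_⟧ : {P : Set} → Dec P → ℕ
⟦ yes _ ⟧ = 1
⟦ no  _ ⟧ = 0

⟦⟧≡0⇒¬ : {P : Set} {P? : Dec P} → ⟦ P? ⟧ ≡ 0 → ¬ P
⟦⟧≡0⇒¬ {P? = no ¬p} _ = ¬p

∑⟦⟧≡length-filter : ∀ {P : Pred A _} (P? : Decidable P) xs → ∑[ a ← xs ] ⟦ P? a ⟧ ≡ length (filter P? xs)
∑⟦⟧≡length-filter P? []       = refl
∑⟦⟧≡length-filter P? (a ∷ as) with P? a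
... | yes _ = cong suc (∑⟦⟧≡length-filter P? as)
... | no  _ = ∑⟦⟧≡length-filter P? as

m<n⇒m*n^k<n*n^k : ∀ {m n} k → m < n → m * n ^ k < n * n ^ k
m<n⇒m*n^k<n*n^k {n = suc _} k m<n = *-monoˡ-< _ {{m^n≢0 _ k}} m<n

_∈∏_ : Vector A r → (Fin r → List A) → Set
α ∈∏ U = ∀ j → α j ∈ U j

∷-∈∏ : ∀ {U : Fin (suc r) → List A} {a β} → a ∈ U zero → β ∈∏ tail U → (a ∷ᵛ β) ∈∏ U
∷-∈∏ a∈ β∈ zero    = a∈
∷-∈∏ a∈ β∈ (suc j) = β∈ j

-- Unlike Data.Vec.Functional.updateAt this recurses on the index, so that
-- (a ∷ᵛ β) [ suc ℓ ]≔ b reduces to a ∷ᵛ (β [ ℓ ]≔ b), as line-bound needs.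
_[_]≔_ : Vector A r → Fin r → A → Vector A r
α [ zero  ]≔ a = a ∷ᵛ tail α
α [ suc ℓ ]≔ a = head α ∷ᵛ (tail α [ ℓ ]≔ a)

[]≔-updates : ∀ (α : Vector A r) ℓ a → (α [ ℓ ]≔ a) ℓ ≡ a
[]≔-updates α zero    a = refl
[]≔-updates α (suc ℓ) a = []≔-updates (tail α) ℓ a

[]≔-minimal : ∀ (α : Vector A r) {ℓ j} a → j ≢ ℓ → (α [ ℓ ]≔ a) j ≡ α j
[]≔-minimal α {zero}  {zero}  a j≢ℓ = contradiction refl j≢ℓ
[]≔-minimal α {zero}  {suc j} a j≢ℓ = refl
[]≔-minimal α {suc ℓ} {zero}  a j≢ℓ = refl
[]≔-minimal α {suc ℓ} {suc j} a j≢ℓ = []≔-minimal (tail α) a (j≢ℓ ∘ cong suc)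

[]≔-preserves : ∀ (P : Fin r → A → Set) {α ℓ a} →
                P ℓ a → (∀ j → j ≢ ℓ → P j (α j)) → ∀ j → P j ((α [ ℓ ]≔ a) j)
[]≔-preserves P {α} {ℓ} {a} Pa Pα j with j ≟ ℓ
... | yes refl = subst (P j) (sym ([]≔-updates α j a)) Pa
... | no  j≢ℓ  = subst (P j) (sym ([]≔-minimal α a j≢ℓ)) (Pα j j≢ℓ)

∑∏ : (Fin r → List A) → (Vector A r → ℕ) → ℕ
∑∏ {r = zero}  U f = f []ᵛ
∑∏ {r = suc r} U f = ∑[ a ← U zero ] ∑∏ (tail U) (λ β → f (a ∷ᵛ β))

∑∏-mono-≤ : ∀ (U : Fin r → List A) {f g} → (∀ α → α ∈∏ U → f α ≤ g α) → ∑∏ U f ≤ ∑∏ U g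
∑∏-mono-≤ {r = zero}  U f≤g = f≤g []ᵛ (λ ())
∑∏-mono-≤ {r = suc r} U f≤g =
  ∑-mono-≤ (U zero) λ a∈ → ∑∏-mono-≤ (tail U) λ β β∈ → f≤g _ (∷-∈∏ a∈ β∈)

∑∏-const : ∀ (U : Fin r → List A) {n} → (∀ j → length (U j) ≡ n) → ∀ c → ∑∏ U (λ _ → c) ≡ c * n ^ r
∑∏-const {r = zero}  U len c = sym (*-identityʳ c)
∑∏-const {r = suc r} U {n} len c = begin
  ∑[ a ← U zero ] ∑∏ (tail U) (λ _ → c) ≡⟨ ∑-cong (U zero) (λ _ → ∑∏-const (tail U) (len ∘ suc) c) ⟩
  ∑[ a ← U zero ] (c * n ^ r)            ≡⟨ ∑-const (U zero) _ ⟩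
  length (U zero) * (c * n ^ r)          ≡⟨ cong (_* (c * n ^ r)) (len zero) ⟩
  n * (c * n ^ r)                        ≡⟨ x∙yz≈y∙xz n c _ ⟩
  c * n ^ suc r                          ∎
  where open ≡-Reasoning

∑∏-∑ : ∀ (U : Fin r → List A) (xs : List C) (f : C → Vector A r → ℕ) →
       ∑∏ U (λ α → ∑[ x ← xs ] f x α) ≡ ∑[ x ← xs ] ∑∏ U (f x)
∑∏-∑ {r = zero}  U xs f = refl
∑∏-∑ {r = suc r} U xs f = begin
  ∑[ a ← U zero ] ∑∏ (tail U) (λ β → ∑[ x ← xs ] f x (a ∷ᵛ β))  ≡⟨ ∑-cong (U zero) (λ _ → ∑∏-∑ (tail U) xs _) ⟩
  ∑[ a ← U zero ] ∑[ x ← xs ] ∑∏ (tail U) (λ β → f x (a ∷ᵛ β))  ≡⟨ ∑-comm (U zero) xs _ ⟩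
  ∑[ x ← xs ] ∑[ a ← U zero ] ∑∏ (tail U) (λ β → f x (a ∷ᵛ β))  ∎
  where open ≡-Reasoning

∑∏<∑∏⇒∃ : ∀ (U : Fin r → List A) {f g} → ∑∏ U f < ∑∏ U g → ∃ λ α → α ∈∏ U × f α < g α
∑∏<∑∏⇒∃ {r = zero}  U fs<gs = []ᵛ , (λ ()) , fs<gs
∑∏<∑∏⇒∃ {r = suc r} U fs<gs =
  let a , a∈ , fa<ga = ∑<∑⇒∃ (U zero) fs<gs
      β , β∈ , fβ<gβ = ∑∏<∑∏⇒∃ (tail U) fa<ga
  in  a ∷ᵛ β , ∷-∈∏ a∈ β∈ , fβ<gβ

line-bound : ∀ (U : Fin r → List A) {n} → (∀ j → length (U j) ≡ n) → ∀ ℓ f c →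
             (∀ α → α ∈∏ U → ∑[ a ← U ℓ ] f (α [ ℓ ]≔ a) ≤ c) → n * ∑∏ U f ≤ c * n ^ r
line-bound {r = suc r} U {n} len zero f c line = begin
  n * ∑∏ U f                                         ≡⟨ cong (n *_) (∑∏-∑ (tail U) (U zero) _) ⟨
  n * ∑∏ (tail U) (λ β → ∑[ a ← U zero ] f (a ∷ᵛ β)) ≤⟨ *-monoʳ-≤ n (∑∏-mono-≤ (tail U) column) ⟩
  n * ∑∏ (tail U) (λ _ → c)                          ≡⟨ cong (n *_) (∑∏-const (tail U) (len ∘ suc) c) ⟩
  n * (c * n ^ r)                                    ≡⟨ x∙yz≈y∙xz n c _ ⟩
  c * n ^ suc r                                      ∎
  where
  open ≤-Reasoning
  column : ∀ β → β ∈∏ tail U → ∑[ a ← U zero ] f (a ∷ᵛ β) ≤ c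
  column β β∈ = ∑-≤-if-inhabited λ a₀∈ → line (_ ∷ᵛ β) (∷-∈∏ a₀∈ β∈)
line-bound {r = suc r} U {n} len (suc ℓ) f c line = begin
  n * ∑∏ U f                                           ≡⟨ *-distribˡ-∑ n (U zero) _ ⟩
  ∑[ a ← U zero ] n * ∑∏ (tail U) (λ β → f (a ∷ᵛ β))   ≤⟨ ∑≤length* (U zero) row ⟩
  length (U zero) * (c * n ^ r)                        ≡⟨ cong (_* (c * n ^ r)) (len zero) ⟩
  n * (c * n ^ r)                                      ≡⟨ x∙yz≈y∙xz n c _ ⟩
  c * n ^ suc r                                        ∎
  where
  open ≤-Reasoning
  row : ∀ {a} → a ∈ U zero → n * ∑∏ (tail U) (λ β → f (a ∷ᵛ β)) ≤ c * n ^ r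
  row a∈ = line-bound (tail U) (len ∘ suc) ℓ _ c λ β β∈ → line (_ ∷ᵛ β) (∷-∈∏ a∈ β∈)

sparse-lines⇒∃-zero : ∀ (U : Fin r → List A) {n} → (∀ j → length (U j) ≡ n) →
  (f : Fin r → Vector A r → ℕ) (c : ℕ) → (∀ ℓ α → α ∈∏ U → ∑[ a ← U ℓ ] f ℓ (α [ ℓ ]≔ a) ≤ c) →
  r * c < n → ∃ λ α → α ∈∏ U × ∀ ℓ → f ℓ α ≡ 0
sparse-lines⇒∃-zero {r = r} U {n} len f c sparse r*c<n =
  let α , α∈U , total<1 = ∑∏<∑∏⇒∃ U (*-cancelˡ-< n _ _ n*total<n*volume)
  in  α , α∈U , λ ℓ → ∑≡0⇒≡0 (n<1⇒n≡0 total<1) (∈-allFin ℓ)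
  where
  open ≤-Reasoning
  n*total<n*volume : n * ∑∏ U (λ α → ∑[ ℓ ← allFin r ] f ℓ α) < n * ∑∏ U (λ _ → 1)
  n*total<n*volume = begin-strict
    n * ∑∏ U (λ α → ∑[ ℓ ← allFin r ] f ℓ α) ≡⟨ cong (n *_) (∑∏-∑ U (allFin r) f) ⟩
    n * (∑[ ℓ ← allFin r ] ∑∏ U (f ℓ))       ≡⟨ *-distribˡ-∑ n (allFin r) _ ⟩
    ∑[ ℓ ← allFin r ] n * ∑∏ U (f ℓ)          ≤⟨ ∑≤length* (allFin r) (λ _ → line-bound U len _ _ c (sparse _)) ⟩
    length (allFin r) * (c * n ^ r)           ≡⟨ cong (_* (c * n ^ r)) (length-tabulate {n = r} id) ⟩
    r * (c * n ^ r)                           ≡⟨ *-assoc r c _ ⟨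
    r * c * n ^ r                             <⟨ m<n⇒m*n^k<n*n^k r r*c<n ⟩
    n * n ^ r                                 ≡⟨ cong (n *_) (trans (∑∏-const U len 1) (*-identityˡ _)) ⟨
    n * ∑∏ U (λ _ → 1)                         ∎

∃-common-length : ∀ {r} (U : Fin r → List A) {u} → (∀ ℓ ℓ′ → length (U ℓ) ≡ length (U ℓ′)) →
                  (∀ ℓ → u ≤ length (U ℓ)) → ∃ λ n → (∀ ℓ → length (U ℓ) ≡ n) × u ≤ n
∃-common-length {r = zero}  U {u} _     _   = u , (λ ()) , ≤-refl
∃-common-length {r = suc r} U     equal u≤U = length (U zero) , (λ ℓ → equal ℓ zero) , u≤U zero

allSubsets : ∀ r → List (Subset r)
allSubsets zero    = [] ∷ []
allSubsets (suc r) = map (inside ∷_) (allSubsets r) ++ map (outside ∷_) (allSubsets r)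

length-allSubsets : ∀ r → length (allSubsets r) ≡ 2 ^ r
length-allSubsets zero    = refl
length-allSubsets (suc r) = begin
  length (map (inside ∷_) (allSubsets r) ++ map (outside ∷_) (allSubsets r))
    ≡⟨ length-++ (map (inside ∷_) (allSubsets r)) ⟩
  length (map (inside ∷_) (allSubsets r)) + length (map (outside ∷_) (allSubsets r))
    ≡⟨ cong₂ _+_ (length-map _ (allSubsets r)) (length-map _ (allSubsets r)) ⟩
  length (allSubsets r) + length (allSubsets r)
    ≡⟨ cong (λ k → k + k) (length-allSubsets r) ⟩
  2 ^ r + 2 ^ r
    ≡⟨ cong (2 ^ r +_) (+-identityʳ (2 ^ r)) ⟨
  2 ^ suc r ∎
  where open ≡-Reasoning

∈-allSubsets : ∀ (S : Subset r) → S ∈ allSubsets r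
∈-allSubsets []            = here refl
∈-allSubsets (inside  ∷ S) = ∈-++⁺ˡ (∈-map⁺ (inside ∷_) (∈-allSubsets S))
∈-allSubsets (outside ∷ S) = ∈-++⁺ʳ _ (∈-map⁺ (outside ∷_) (∈-allSubsets S))

⊆⇒≡⊎⊂ : ∀ {p q : Subset r} → p ⊆ q → p ≡ q ⊎ p ⊂ q
⊆⇒≡⊎⊂ {p = p} {q} p⊆q with p ⊂? q
... | yes p⊂q = inj₂ p⊂q
... | no  p⊄q = inj₁ (⊆-antisym p⊆q q⊆p)
  where
  q⊆p : q ⊆ p
  q⊆p {x} x∈q = decidable-stable (x ∈? p) λ x∉p → p⊄q (p⊆q , x , x∈q , x∉p)

⊈⇒∩⊂ : ∀ {p q : Subset r} → p ⊈ q → p ∩ q ⊂ p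
⊈⇒∩⊂ {p = p} {q} p⊈q with ⊆⇒≡⊎⊂ (p∩q⊆p p q)
... | inj₂ p∩q⊂p = p∩q⊂p
... | inj₁ p∩q≡p = contradiction (λ {x} x∈p → p∩q⊆q p q (subst (x ∈ₛ_) (sym p∩q≡p) x∈p)) p⊈q

x∈p⇒p∪⁅x⁆≡p : ∀ {x} {p : Subset r} → x ∈ₛ p → p ∪ ⁅ x ⁆ ≡ p
x∈p⇒p∪⁅x⁆≡p {x = x} {p} x∈p = ⊆-antisym p∪⁅x⁆⊆p (p⊆p∪q ⁅ x ⁆)
  where
  p∪⁅x⁆⊆p : p ∪ ⁅ x ⁆ ⊆ p
  p∪⁅x⁆⊆p y∈ with x∈p∪q⁻ p ⁅ x ⁆ y∈
  ... | inj₁ y∈p    = y∈p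
  ... | inj₂ y∈⁅x⁆ = subst (_∈ₛ p) (sym (x∈⁅y⁆⇒x≡y x y∈⁅x⁆)) x∈p

insertAll : Subset r → List (Fin r) → Subset r
insertAll R []       = R
insertAll R (j ∷ js) = insertAll R js ∪ ⁅ j ⁆

∈-insertAll⁻ : ∀ (R : Subset r) js {i} → i ∈ₛ insertAll R js → i ∈ₛ R ⊎ i ∈ js
∈-insertAll⁻ R []       i∈ = inj₁ i∈
∈-insertAll⁻ R (j ∷ js) i∈ with x∈p∪q⁻ (insertAll R js) ⁅ j ⁆ i∈
... | inj₁ i∈js  = Sum.map₂ there (∈-insertAll⁻ R js i∈js)
... | inj₂ i∈⁅j⁆ = inj₂ (here (x∈⁅y⁆⇒x≡y j i∈⁅j⁆))

∈-insertAll⁺ : ∀ (R : Subset r) js {i} → i ∈ₛ R ⊎ i ∈ js → i ∈ₛ insertAll R js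
∈-insertAll⁺ R []       (inj₁ i∈R)         = i∈R
∈-insertAll⁺ R (j ∷ js) (inj₁ i∈R)         = p⊆p∪q _ (∈-insertAll⁺ R js (inj₁ i∈R))
∈-insertAll⁺ R (j ∷ js) (inj₂ (here refl)) = q⊆p∪q _ _ (x∈⁅x⁆ j)
∈-insertAll⁺ R (j ∷ js) (inj₂ (there i∈))  = p⊆p∪q _ (∈-insertAll⁺ R js (inj₂ i∈))

insert-invariant : ∀ (f : Subset r → C) (E : Fin r → Set) →
  (∀ R {j} → j ∉ₛ R → E j → f (R ∪ ⁅ j ⁆) ≡ f R) →
  ∀ {R T} → R ⊆ T → (∀ {j} → j ∈ₛ T → j ∉ₛ R → E j) → f T ≡ f R
insert-invariant {r = r} f E step {R} {T} R⊆T new⇒E =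
  trans (cong f (sym insertAll-new≡T)) (grow new (All.tabulate λ j∈ → Product.uncurry new⇒E (new⁻ j∈)))
  where
  new? : Decidable (λ j → j ∈ₛ T × j ∉ₛ R)
  new? j = j ∈? T ×-dec ¬? (j ∈? R)

  new : List (Fin r)
  new = filter new? (allFin r)

  new⁻ : ∀ {j} → j ∈ new → j ∈ₛ T × j ∉ₛ R
  new⁻ = proj₂ ∘ ∈-filter⁻ new? {xs = allFin r}

  grow : ∀ js → All E js → f (insertAll R js) ≡ f R
  grow []       []          = refl
  grow (j ∷ js) (Ej ∷ E-js) with j ∈? insertAll R js
  ... | yes j∈ = trans (cong f (x∈p⇒p∪⁅x⁆≡p j∈)) (grow js E-js)
  ... | no  j∉ = trans (step _ j∉ Ej) (grow js E-js)

  T⊆R∪new : ∀ {i} → i ∈ₛ T → i ∈ₛ R ⊎ i ∈ new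
  T⊆R∪new {i} i∈T with i ∈? R
  ... | yes i∈R = inj₁ i∈R
  ... | no  i∉R = inj₂ (∈-filter⁺ new? (∈-allFin i) (i∈T , i∉R))

  insertAll-new≡T : insertAll R new ≡ T
  insertAll-new≡T = ⊆-antisym ([ R⊆T , proj₁ ∘ new⁻ ]′ ∘ ∈-insertAll⁻ R new) (∈-insertAll⁺ R new ∘ T⊆R∪new)

data Path : Tree → Set where
  stop      : Path accept
  left      : ∀ {l r} → Path l → Path (branch l r)
  right     : ∀ {l r} → Path r → Path (branch l r)
  member    : ∀ {w y n} → Path y → Path (query w y n)
  nonmember : ∀ {w y n} → Path n → Path (query w y n)

Consistent : StrSet → ∀ {T} → Path T → Set
Consistent B stop                 = ⊤
Consistent B (left P)             = Consistent B P
Consistent B (right P)            = Consistent B P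
Consistent B (member {w} P)       = B w ≡ true  × Consistent B P
Consistent B (nonmember {w} P)    = B w ≡ false × Consistent B P

queries : ∀ {T} → Path T → List String
queries stop                 = []
queries (left P)             = queries P
queries (right P)            = queries P
queries (member {w} P)       = w ∷ queries P
queries (nonmember {w} P)    = w ∷ queries P

module _ {B : StrSet} where

  consistent⇒accepts : ∀ {T} (P : Path T) → Consistent B P → 1 ≤ #acc B T
  consistent⇒accepts stop                        _        = ≤-refl
  consistent⇒accepts {branch l r} (left P)  c = ≤-trans (consistent⇒accepts P c) (m≤m+n (#acc B l) (#acc B r))
  consistent⇒accepts {branch l r} (right P) c = ≤-trans (consistent⇒accepts P c) (m≤n+m (#acc B r) (#acc B l))
  consistent⇒accepts (member P)    (Bw , c) rewrite Bw = consistent⇒accepts P c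
  consistent⇒accepts (nonmember P) (Bw , c) rewrite Bw = consistent⇒accepts P c

  two-paths⇒2≤#acc : ∀ {T} (P Q : Path T) → Consistent B P → Consistent B Q → P ≢ Q → 2 ≤ #acc B T
  two-paths⇒2≤#acc stop          stop          _ _ P≢Q = contradiction refl P≢Q
  two-paths⇒2≤#acc (left P)      (left Q)      c d P≢Q =
    ≤-trans (two-paths⇒2≤#acc P Q c d (P≢Q ∘ cong left)) (m≤m+n _ _)
  two-paths⇒2≤#acc (right P)     (right Q)     c d P≢Q =
    ≤-trans (two-paths⇒2≤#acc P Q c d (P≢Q ∘ cong right)) (m≤n+m _ _)
  two-paths⇒2≤#acc (left P)      (right Q)     c d _   = +-mono-≤ (consistent⇒accepts P c) (consistent⇒accepts Q d)
  two-paths⇒2≤#acc (right P)     (left Q)      c d _   = +-mono-≤ (consistent⇒accepts Q d) (consistent⇒accepts P c)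
  two-paths⇒2≤#acc (member P)    (member Q)    (Bw , c) (_ , d) P≢Q rewrite Bw =
    two-paths⇒2≤#acc P Q c d (P≢Q ∘ cong member)
  two-paths⇒2≤#acc (nonmember P) (nonmember Q) (Bw , c) (_ , d) P≢Q rewrite Bw =
    two-paths⇒2≤#acc P Q c d (P≢Q ∘ cong nonmember)
  two-paths⇒2≤#acc (member P)    (nonmember Q) (Bw , _) (¬Bw , _) _ = contradiction (trans (sym Bw) ¬Bw) λ ()
  two-paths⇒2≤#acc (nonmember P) (member Q)    (¬Bw , _) (Bw , _) _ = contradiction (trans (sym Bw) ¬Bw) λ ()

consistent-transfer : ∀ {B B′ T} (P : Path T) → Consistent B P →
                      (∀ {w} → w ∈ queries P → B w ≡ B′ w) → Consistent B′ P
consistent-transfer stop          c        agree = tt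
consistent-transfer (left P)      c        agree = consistent-transfer P c agree
consistent-transfer (right P)     c        agree = consistent-transfer P c agree
consistent-transfer (member P)    (Bw , c) agree =
  trans (sym (agree (here refl))) Bw , consistent-transfer P c (agree ∘ there)
consistent-transfer (nonmember P) (Bw , c) agree =
  trans (sym (agree (here refl))) Bw , consistent-transfer P c (agree ∘ there)

queries-cost≤time : ∀ {T} (P : Path T) → ∑[ w ← queries P ] suc (length w) ≤ time T
queries-cost≤time stop                        = z≤n
queries-cost≤time {branch l r}  (left P)      =
  ≤-trans (queries-cost≤time P) (m≤n⇒m≤1+n (m≤m⊔n (time l) (time r)))
queries-cost≤time {branch l r}  (right P)     =
  ≤-trans (queries-cost≤time P) (m≤n⇒m≤1+n (m≤n⊔m (time l) (time r)))
queries-cost≤time {query w y n} (member P)    =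
  +-monoʳ-≤ (suc (length w)) (≤-trans (queries-cost≤time P) (m≤m⊔n (time y) (time n)))
queries-cost≤time {query w y n} (nonmember P) =
  +-monoʳ-≤ (suc (length w)) (≤-trans (queries-cost≤time P) (m≤n⊔m (time y) (time n)))

acceptingPath? : ∀ B T → Σ (Path T) (Consistent B) ⊎ #acc B T ≡ 0
acceptingPath? B accept = inj₁ (stop , tt)
acceptingPath? B reject = inj₂ refl
acceptingPath? B (branch l r) with acceptingPath? B l | acceptingPath? B r
... | inj₁ (P , c) | _            = inj₁ (left P , c)
... | inj₂ _       | inj₁ (P , c) = inj₁ (right P , c)
... | inj₂ l≡0     | inj₂ r≡0     = inj₂ (cong₂ _+_ l≡0 r≡0)
acceptingPath? B (query w y n) with B w in Bw
... | true  = Sum.map₁ (λ (P , c) → member P , Bw , c) (acceptingPath? B y)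
... | false = Sum.map₁ (λ (P , c) → nonmember P , Bw , c) (acceptingPath? B n)

firstQueries : StrSet → Tree → List String
firstQueries B T = [ queries ∘ proj₁ , (λ _ → []) ]′ (acceptingPath? B T)

first-accepting-path : ∀ B T → 1 ≤ #acc B T → Σ (Path T) λ P → Consistent B P × queries P ≡ firstQueries B T
first-accepting-path B T acc with acceptingPath? B T
... | inj₁ (P , c) = P , c , refl
... | inj₂ none    = contradiction (subst (1 ≤_) none acc) λ ()

firstQueries-cost≤time : ∀ B T → ∑[ w ← firstQueries B T ] suc (length w) ≤ time T
firstQueries-cost≤time B T with acceptingPath? B T
... | inj₁ (P , _) = queries-cost≤time P
... | inj₂ _       = z≤n

#acc-cong : ∀ {B B′} → B ≐ B′ → ∀ T → #acc B T ≡ #acc B′ T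
#acc-cong B≐B′ accept        = refl
#acc-cong B≐B′ reject        = refl
#acc-cong B≐B′ (branch l r)  = cong₂ _+_ (#acc-cong B≐B′ l) (#acc-cong B≐B′ r)
#acc-cong {B} {B′} B≐B′ (query w y n) with B w | B′ w | B≐B′ w
... | true  | .true  | refl = #acc-cong B≐B′ y
... | false | .false | refl = #acc-cong B≐B′ n

∈ᵇ⇔∈ : ∀ {w} xs → w ∈ᵇ xs ≡ true ⇔ w ∈ xs
∈ᵇ⇔∈     []       = mk⇔ (λ ()) (λ ())
∈ᵇ⇔∈ {w} (v ∷ xs) with w ≟s v
... | yes refl = mk⇔ (λ _ → here refl) (λ _ → refl)
... | no  w≢v  = mk⇔ (there ∘ to (∈ᵇ⇔∈ xs)) λ where
  (here w≡v) → contradiction w≡v w≢v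
  (there w∈) → from (∈ᵇ⇔∈ xs) w∈

∉⇒∈ᵇ≡false : ∀ {w} xs → w ∉ xs → w ∈ᵇ xs ≡ false
∉⇒∈ᵇ≡false {w} xs w∉ with w ∈ᵇ xs in eq
... | true  = contradiction (to (∈ᵇ⇔∈ xs) eq) w∉
... | false = refl

∈ᵇ-++ : ∀ w xs ys → w ∈ᵇ (xs ++ ys) ≡ (w ∈ᵇ xs) ∨ (w ∈ᵇ ys)
∈ᵇ-++ w []       ys = refl
∈ᵇ-++ w (v ∷ xs) ys =
  trans (cong (isYes (w ≟s v) ∨_) (∈ᵇ-++ w xs ys)) (sym (∨-assoc (isYes (w ≟s v)) (w ∈ᵇ xs) (w ∈ᵇ ys)))

∪L-cong : ∀ O {xs ys} → (∀ {w} → w ∈ xs → w ∈ ys) → (∀ {w} → w ∈ ys → w ∈ xs) → (O ∪L xs) ≐ (O ∪L ys)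
∪L-cong O {xs} {ys} xs⊆ys ys⊆xs w = cong (O w ∨_) (⇔→≡ (mk⇔
  (from (∈ᵇ⇔∈ ys) ∘ xs⊆ys ∘ to (∈ᵇ⇔∈ xs))
  (from (∈ᵇ⇔∈ xs) ∘ ys⊆xs ∘ to (∈ᵇ⇔∈ ys))))

∪L-++ : ∀ O xs ys → ((O ∪L xs) ∪L ys) ≐ (O ∪L (xs ++ ys))
∪L-++ O xs ys w = trans (∨-assoc (O w) _ _) (cong (O w ∨_) (sym (∈ᵇ-++ w xs ys)))

module _ {r} (α : Vector String r) where

  ∈-pick⁻ : ∀ {S w} → w ∈ pick α S → ∃ λ j → j ∈ₛ S × w ≡ α j
  ∈-pick⁻ {S} w∈ =
    let j , j∈ , w≡αj = ∈-map⁻ α w∈ in j , proj₂ (∈-filter⁻ (_∈? S) {xs = allFin r} j∈) , w≡αj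

  ∈-pick⁺ : ∀ {S j} → j ∈ₛ S → α j ∈ pick α S
  ∈-pick⁺ {S} {j} j∈S = ∈-map⁺ α (∈-filter⁺ (_∈? S) (∈-allFin j) j∈S)

  pick-[]≔ : ∀ {S ℓ} a → ℓ ∉ₛ S → pick (α [ ℓ ]≔ a) S ≡ pick α S
  pick-[]≔ {S} {ℓ} a ℓ∉S = map-cong-local (All.tabulate λ j∈ →
    []≔-minimal α {ℓ} a λ { refl → ℓ∉S (proj₂ (∈-filter⁻ (_∈? S) {xs = allFin r} j∈)) })

  pick-∪⁅⁆ : ∀ O R j → ((O ∪L pick α R) ∪L (α j ∷ [])) ≐ (O ∪L pick α (R ∪ ⁅ j ⁆))
  pick-∪⁅⁆ O R j w = trans (∪L-++ O (pick α R) (α j ∷ []) w) (∪L-cong O ⊆new new⊆ w)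
    where
    ⊆new : ∀ {v} → v ∈ pick α R ++ (α j ∷ []) → v ∈ pick α (R ∪ ⁅ j ⁆)
    ⊆new v∈ with ∈-++⁻ (pick α R) v∈
    ... | inj₂ (here refl) = ∈-pick⁺ (q⊆p∪q R ⁅ j ⁆ (x∈⁅x⁆ j))
    ... | inj₁ v∈R with ∈-pick⁻ v∈R
    ...   | i , i∈R , refl = ∈-pick⁺ (p⊆p∪q ⁅ j ⁆ i∈R)
    new⊆ : ∀ {v} → v ∈ pick α (R ∪ ⁅ j ⁆) → v ∈ pick α R ++ (α j ∷ [])
    new⊆ v∈ with ∈-pick⁻ v∈
    ... | i , i∈ , refl with x∈p∪q⁻ R ⁅ j ⁆ i∈
    ...   | inj₁ i∈R   = ∈-++⁺ˡ (∈-pick⁺ i∈R)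
    ...   | inj₂ i∈⁅j⁆ = ∈-++⁺ʳ (pick α R) (here (cong α (x∈⁅y⁆⇒x≡y j i∈⁅j⁆)))

  ∪L-pick-∅ : ∀ O → O ≐ (O ∪L pick α ∅)
  ∪L-pick-∅ O w =
    sym (trans (cong (O w ∨_) (∉⇒∈ᵇ≡false (pick α ∅) (∉⊥ ∘ proj₁ ∘ proj₂ ∘ ∈-pick⁻))) (∨-identityʳ (O w)))

∈-⋃L⁻ : ∀ {r} (F : Fin r → List String) {w} → w ∈ ⋃L F → ∃ λ j → w ∈ F j
∈-⋃L⁻ {r} F w∈ = let xs , w∈xs , xs∈ = ∈-concat⁻′ (map F (allFin r)) w∈
                     j , _ , xs≡Fj = ∈-map⁻ F xs∈
                 in  j , subst (_ ∈_) xs≡Fj w∈xs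

∈-⋃L⁺ : ∀ {r} (F : Fin r → List String) {w} j → w ∈ F j → w ∈ ⋃L F
∈-⋃L⁺ F j w∈ = ∈-concat⁺′ w∈ (∈-map⁺ F (∈-allFin j))

pickAt : ∀ {r} → Vector String r → Subset r → Fin r → List String
pickAt α S j with j ∈? S
... | yes _ = α j ∷ []
... | no  _ = []

module _ {r} (α : Vector String r) (S : Subset r) where

  ∈-pickAt⁻ : ∀ {j w} → w ∈ pickAt α S j → j ∈ₛ S × w ≡ α j
  ∈-pickAt⁻ {j} w∈ with j ∈? S
  ∈-pickAt⁻ (here w≡αj) | yes j∈S = j∈S , w≡αj

  ∈-pickAt⁺ : ∀ {j} → j ∈ₛ S → α j ∈ pickAt α S j
  ∈-pickAt⁺ {j} j∈S with j ∈? S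
  ... | yes _   = here refl
  ... | no  j∉S = contradiction j∈S j∉S

  length-pickAt≤1 : ∀ j → length (pickAt α S j) ≤ 1
  length-pickAt≤1 j with j ∈? S
  ... | yes _ = ≤-refl
  ... | no  _ = z≤n

  pick⊆⋃pickAt : ∀ {w} → w ∈ pick α S → w ∈ ⋃L (pickAt α S)
  pick⊆⋃pickAt w∈ with ∈-pick⁻ α w∈
  ... | j , j∈S , refl = ∈-⋃L⁺ (pickAt α S) j (∈-pickAt⁺ j∈S)

  ⋃pickAt⊆pick : ∀ {w} → w ∈ ⋃L (pickAt α S) → w ∈ pick α S
  ⋃pickAt⊆pick w∈ with ∈-⋃L⁻ (pickAt α S) w∈
  ... | j , w∈j with ∈-pickAt⁻ w∈j
  ...   | j∈S , refl = ∈-pick⁺ α j∈S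

module _ {X : Set} {P : X → Set} {m : Maybe X} {x : X} where

  Any-≡just⁺ : m ≡ just x → P x → Any P m
  Any-≡just⁺ refl = just

  Any-≡just⁻ : m ≡ just x → Any P m → P x
  Any-≡just⁻ refl (just px) = px

Is-just⇒≡just : ∀ {X : Set} {m : Maybe X} (j : Is-just m) → m ≡ just (to-witness j)
Is-just⇒≡just (just _) = refl

module _ (L : SetFun) {S T : StrSet} (S≐T : S ≐ T) where

  app-≐-Is-just : Is-just (app L T) → Is-just (app L S)
  app-≐-Is-just = go (ext L S≐T)
    where
    go : ∀ {m₁ m₂} → Pointwise _≐_ m₁ m₂ → Is-just m₂ → Is-just m₁
    go (just _) (just _) = just tt

  app-≐-just : ∀ {B} → app L T ≡ just B → ∃ λ B′ → app L S ≡ just B′ × B′ ≐ B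
  app-≐-just T↦B = go (subst (Pointwise _≐_ (app L S)) T↦B (ext L S≐T))
    where
    go : ∀ {m B} → Pointwise _≐_ m (just B) → ∃ λ B′ → m ≡ just B′ × B′ ≐ B
    go (just B′≐B) = _ , refl , B′≐B

flips? : ∀ L O a w → Dec (Flips L O a w)
flips? L O a w =
  MaybeAny.dec (λ Bα → MaybeAny.dec (λ BO → ¬? (Bα w Bool.≟ BO w)) (app L O)) (app L (O ∪L (a ∷ [])))

¬Flips⇒agree : ∀ {L O a w B₀ B₁} → app L (O ∪L (a ∷ [])) ≡ just B₁ → app L O ≡ just B₀ →
               ¬ Flips L O a w → B₁ w ≡ B₀ w
¬Flips⇒agree {L} {O} {a} {w} {B₀} {B₁} O+a↦B₁ O↦B₀ no-flip =
  decidable-stable (B₁ w Bool.≟ B₀ w) λ B₁w≢B₀w →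
    no-flip (Any-≡just⁺ O+a↦B₁ (Any-≡just⁺ O↦B₀ B₁w≢B₀w))

flips≤t : ∀ {h t L} → Ambiguous h t L → ∀ O {V} → Unique V → (∀ {v} → v ∈ V → O v ≡ false) →
  (∀ A → All (_∈ V) A → length A ≤ h → Is-just (app L (O ∪L A))) →
  ∀ w → ∑[ a ← V ] ⟦ flips? L O a w ⟧ ≤ eval t (length w)
flips≤t {h} {t} {L} ambiguous O {V} V-unique V∩O≡∅ defined w = begin
  ∑[ a ← V ] ⟦ flips? L O a w ⟧ ≡⟨ ∑⟦⟧≡length-filter (λ a → flips? L O a w) V ⟩
  length flipping             ≤⟨ ambiguous O (_∈ᵇ V) disjoint defined-∈ᵇ w flipping
                                   (Unique.filter⁺ (λ a → flips? L O a w) V-unique)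
                                   (All.tabulate (Product.map₁ (from (∈ᵇ⇔∈ V)) ∘ ∈-filter⁻ _ {xs = V})) ⟩
  eval t (length w)           ∎
  where
  open ≤-Reasoning
  flipping : List String
  flipping = filter (λ a → flips? L O a w) V
  disjoint : ∀ v → O v ≡ true → v ∈ᵇ V ≡ false
  disjoint v Ov = ∉⇒∈ᵇ≡false V λ v∈V → contradiction (trans (sym Ov) (V∩O≡∅ v∈V)) λ ()
  defined-∈ᵇ : ∀ A → All (λ a → a ∈ᵇ V ≡ true) A → length A ≤ h → Is-just (app L (O ∪L A))
  defined-∈ᵇ A A⊆V = defined A (All.map (to (∈ᵇ⇔∈ V)) A⊆V)

eval-mono : ∀ t {a b} → a ≤ b → eval t a ≤ eval t b
eval-mono []       a≤b = z≤n
eval-mono (c ∷ cs) a≤b = +-monoʳ-≤ c (*-mono-≤ a≤b (eval-mono cs a≤b))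

module _ {p} {N : NOTM p} {x : String} where

  ¬accepts×rejects : ∀ {m} → Any (λ B → Accepts N B x) m → Any (λ B → Rejects N B x) m → ⊥
  ¬accepts×rejects (just acc) (just rej) = contradiction (subst (1 ≤_) rej acc) λ ()

  minimal⇒⊈ : ∀ {L O r} {α : Vector String r} {S₁ S₂} → AccWith L N O α S₁ x →
              MinimalAcc L N O α S₂ x → S₁ ≢ S₂ → S₁ ⊈ S₂
  minimal⇒⊈ acc₁ (_ , min₂) S₁≢S₂ S₁⊆S₂ with ⊆⇒≡⊎⊂ S₁⊆S₂
  ... | inj₁ S₁≡S₂ = S₁≢S₂ S₁≡S₂
  ... | inj₂ S₁⊂S₂ = ¬accepts×rejects acc₁ (min₂ _ S₁⊂S₂)

module Construction
  {h : ℕ} (1≤h : 1 ≤ h) {t p : Poly} (N : NOTM p) (O : StrSet)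
  (Z : List String) {m : ℕ} (Z≤m : All (λ z → length z ≤ m) Z)
  {r : ℕ} (U : Fin r → List String) {n : ℕ} (U-length : ∀ ℓ → length (U ℓ) ≡ n)
  (U-unique : ∀ ℓ → Unique (U ℓ))
  (U∩O≡∅ : ∀ ℓ w → w ∈L U ℓ → O w ≡ false)
  (U-disjoint : ∀ ℓ ℓ′ w → ℓ ≢ ℓ′ → w ∈L U ℓ → w ∈L U ℓ′ → ⊥)
  (L : SetFun) (L-ambiguous : Ambiguous h t L)
  (L-defined : ∀ (A : Fin r → List String) → (∀ ℓ → All (λ a → a ∈L U ℓ) (A ℓ)) →
               (∀ ℓ → length (A ℓ) ≤ h) → Is-just (app L (O ∪L ⋃L A)))
  where

  pm tpm : ℕ
  pm  = eval p m
  tpm = eval t pm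

  oracle : Vector String r → Subset r → Maybe StrSet
  oracle α S = app L (O ∪L pick α S)

  -- [] when L(O ∪ xs) is undefined or N rejects.
  queriesOf : String → List String → List String
  queriesOf z xs = maybe′ (λ B → firstQueries B (run N z)) [] (app L (O ∪L xs))

  time≤pm : ∀ {z} → z ∈ Z → time (run N z) ≤ pm
  time≤pm {z} z∈Z = ≤-trans (timed N z) (eval-mono p (All.lookup Z≤m z∈Z))

  queriesOf-cost≤pm : ∀ {z} → z ∈ Z → ∀ xs → ∑[ w ← queriesOf z xs ] suc (length w) ≤ pm
  queriesOf-cost≤pm {z} z∈Z xs with app L (O ∪L xs)
  ... | just B  = ≤-trans (firstQueries-cost≤time B (run N z)) (time≤pm z∈Z)
  ... | nothing = z≤n

  defined-by-family : ∀ (F : Fin r → List String) → (∀ j → All (_∈ U j) (F j)) → (∀ j → length (F j) ≤ h) →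
               ∀ {xs} → (∀ {w} → w ∈ xs → w ∈ ⋃L F) → (∀ {w} → w ∈ ⋃L F → w ∈ xs) →
               Is-just (app L (O ∪L xs))
  defined-by-family F F⊆U F≤h xs⊆F F⊆xs = app-≐-Is-just L (∪L-cong O xs⊆F F⊆xs) (L-defined F F⊆U F≤h)

  module _ {α : Vector String r} (α∈U : α ∈∏ U) where

    pickAt⊆U : ∀ R j → All (_∈ U j) (pickAt α R j)
    pickAt⊆U R j = All.tabulate λ w∈ →
      let _ , w≡αj = ∈-pickAt⁻ α R w∈ in subst (_∈ U j) (sym w≡αj) (α∈U j)

    oracle-defined : ∀ S → Is-just (oracle α S)
    oracle-defined S = defined-by-family (pickAt α S) (pickAt⊆U S) (λ j → ≤-trans (length-pickAt≤1 α S j) 1≤h)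
                                  (pick⊆⋃pickAt α S) (⋃pickAt⊆pick α S)

    extension-defined : ∀ {ℓ R} → ℓ ∉ₛ R → ∀ A → All (_∈ U ℓ) A → length A ≤ h →
                        Is-just (app L ((O ∪L pick α R) ∪L A))
    extension-defined {ℓ} {R} ℓ∉R A A⊆Uℓ A≤h =
      app-≐-Is-just L (∪L-++ O (pick α R) A)
        (defined-by-family F
          ([]≔-preserves (λ j xs → All (_∈ U j) xs) {pickAt α R} {ℓ} A⊆Uℓ (λ j _ → pickAt⊆U R j))
          ([]≔-preserves (λ _ xs → length xs ≤ h) {pickAt α R} {ℓ} A≤h
                         (λ j _ → ≤-trans (length-pickAt≤1 α R j) 1≤h))
          ⊆F F⊆)
      where
      F : Fin r → List String
      F = pickAt α R [ ℓ ]≔ A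
      ⊆F : ∀ {w} → w ∈ pick α R ++ A → w ∈ ⋃L F
      ⊆F w∈ with ∈-++⁻ (pick α R) w∈
      ... | inj₂ w∈A = ∈-⋃L⁺ F ℓ (subst (_ ∈_) (sym ([]≔-updates (pickAt α R) ℓ A)) w∈A)
      ... | inj₁ w∈R with ∈-pick⁻ α w∈R
      ...   | j , j∈R , refl =
        ∈-⋃L⁺ F j (subst (_ ∈_) (sym ([]≔-minimal (pickAt α R) A j≢ℓ)) (∈-pickAt⁺ α R j∈R))
        where
        j≢ℓ : j ≢ ℓ
        j≢ℓ refl = ℓ∉R j∈R
      F⊆ : ∀ {w} → w ∈ ⋃L F → w ∈ pick α R ++ A
      F⊆ {w} w∈ = let j , w∈Fj = ∈-⋃L⁻ F w∈ in
        []≔-preserves (λ _ xs → w ∈ xs → w ∈ pick α R ++ A) {pickAt α R} {ℓ} (∈-++⁺ʳ (pick α R))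
                      (λ j _ w∈j → ∈-++⁺ˡ (⋃pickAt⊆pick α R (∈-⋃L⁺ (pickAt α R) j w∈j))) j w∈Fj

    O∪pick-disjoint-U : ∀ {ℓ R v} → ℓ ∉ₛ R → v ∈ U ℓ → (O ∪L pick α R) v ≡ false
    O∪pick-disjoint-U {ℓ} {R} {v} ℓ∉R v∈Uℓ = cong₂ _∨_ (U∩O≡∅ ℓ v v∈Uℓ) (∉⇒∈ᵇ≡false (pick α R) v∉R)
      where
      v∉R : v ∉ pick α R
      v∉R v∈R with ∈-pick⁻ α v∈R
      ... | j , j∈R , refl = U-disjoint j ℓ (α j) (λ { refl → ℓ∉R j∈R }) (α∈U j) v∈Uℓ

  avoiding : Fin r → List (Subset r)
  avoiding ℓ = filter (λ S → ¬? (ℓ ∈? S)) (allSubsets r)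

  ∈-avoiding⁺ : ∀ {ℓ S} → ℓ ∉ₛ S → S ∈ avoiding ℓ
  ∈-avoiding⁺ {ℓ} {S} ℓ∉S = ∈-filter⁺ (λ S → ¬? (ℓ ∈? S)) (∈-allSubsets S) ℓ∉S

  ∈-avoiding⁻ : ∀ {ℓ S} → S ∈ avoiding ℓ → ℓ ∉ₛ S
  ∈-avoiding⁻ {ℓ} S∈ = proj₂ (∈-filter⁻ (λ S → ¬? (ℓ ∈? S)) {xs = allSubsets r} S∈)

  length-avoiding≤2^r : ∀ ℓ → length (avoiding ℓ) ≤ 2 ^ r
  length-avoiding≤2^r ℓ =
    ≤-trans (length-filter (λ S → ¬? (ℓ ∈? S)) (allSubsets r)) (≤-reflexive (length-allSubsets r))

  flipWeight : String → List String → List String → String → ℕ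
  flipWeight z xs ys a = ∑[ w ← queriesOf z xs ] ⟦ flips? L (O ∪L ys) a w ⟧

  -- S selects the path whose queries matter, R the set to which α ℓ is added.
  flipsAt : Fin r → Vector String r → ℕ
  flipsAt ℓ α =
    ∑[ z ← Z ] ∑[ S ← avoiding ℓ ] ∑[ R ← avoiding ℓ ] flipWeight z (pick α S) (pick α R) (α ℓ)

  flipWeight-[]≔ : ∀ z (α : Vector String r) {ℓ S R} a → ℓ ∉ₛ S → ℓ ∉ₛ R →
    flipWeight z (pick (α [ ℓ ]≔ a) S) (pick (α [ ℓ ]≔ a) R) ((α [ ℓ ]≔ a) ℓ) ≡
    flipWeight z (pick α S) (pick α R) a
  flipWeight-[]≔ z α {ℓ} a ℓ∉S ℓ∉R
    rewrite pick-[]≔ α a ℓ∉S | pick-[]≔ α a ℓ∉R | []≔-updates α ℓ a = refl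

  flipWeight-line : ∀ {α} → α ∈∏ U → ∀ {z ℓ S R} → z ∈ Z → ℓ ∉ₛ S → ℓ ∉ₛ R →
    ∑[ a ← U ℓ ] flipWeight z (pick (α [ ℓ ]≔ a) S) (pick (α [ ℓ ]≔ a) R) ((α [ ℓ ]≔ a) ℓ) ≤ pm * tpm
  flipWeight-line {α} α∈U {z} {ℓ} {S} {R} z∈Z ℓ∉S ℓ∉R = begin
    ∑[ a ← U ℓ ] flipWeight z (pick (α [ ℓ ]≔ a) S) (pick (α [ ℓ ]≔ a) R) ((α [ ℓ ]≔ a) ℓ)
      ≡⟨ ∑-cong (U ℓ) (λ {a} _ → flipWeight-[]≔ z α a ℓ∉S ℓ∉R) ⟩
    ∑[ a ← U ℓ ] ∑[ w ← Q ] ⟦ flips? L (O ∪L pick α R) a w ⟧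
      ≤⟨ ∑-comm-≤ (U ℓ) Q flips≤tpm ⟩
    length Q * tpm
      ≤⟨ *-monoˡ-≤ tpm (≤-trans (length≤∑suc Q {length}) (queriesOf-cost≤pm z∈Z (pick α S))) ⟩
    pm * tpm ∎
    where
    open ≤-Reasoning
    Q : List String
    Q = queriesOf z (pick α S)
    flips≤tpm : ∀ {w} → w ∈ Q → ∑[ a ← U ℓ ] ⟦ flips? L (O ∪L pick α R) a w ⟧ ≤ tpm
    flips≤tpm {w} w∈ = ≤-trans
      (flips≤t {h} {t} {L} L-ambiguous (O ∪L pick α R) (U-unique ℓ)
               (O∪pick-disjoint-U α∈U ℓ∉R) (extension-defined α∈U ℓ∉R) w)
      (eval-mono t (<⇒≤ (<-≤-trans (∈⇒≤∑ w∈) (queriesOf-cost≤pm z∈Z (pick α S)))))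

  flipsAt-line : ∀ ℓ α → α ∈∏ U →
                 ∑[ a ← U ℓ ] flipsAt ℓ (α [ ℓ ]≔ a) ≤ length Z * (2 ^ r * (2 ^ r * (pm * tpm)))
  flipsAt-line ℓ α α∈U = ∑-comm-≤ (U ℓ) Z λ z∈Z → begin
    ∑[ a ← U ℓ ] ∑[ S ← avoiding ℓ ] ∑[ R ← avoiding ℓ ] _
      ≤⟨ ∑-comm-≤ (U ℓ) (avoiding ℓ) (λ S∈ → ∑-comm-≤ (U ℓ) (avoiding ℓ) λ R∈ →
           flipWeight-line α∈U z∈Z (∈-avoiding⁻ S∈) (∈-avoiding⁻ R∈)) ⟩
    length (avoiding ℓ) * (length (avoiding ℓ) * (pm * tpm))
      ≤⟨ *-mono-≤ (length-avoiding≤2^r ℓ) (*-monoˡ-≤ (pm * tpm) (length-avoiding≤2^r ℓ)) ⟩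
    2 ^ r * (2 ^ r * (pm * tpm)) ∎
    where open ≤-Reasoning

  module FlipFree (α : Vector String r) (α∈U : α ∈∏ U) (no-flips : ∀ ℓ → flipsAt ℓ α ≡ 0) where

    abstract
      B : Subset r → StrSet
      B S = to-witness (oracle-defined α∈U S)

      oracle≡B : ∀ S → oracle α S ≡ just (B S)
      oracle≡B S = Is-just⇒≡just (oracle-defined α∈U S)

    Q : String → Subset r → List String
    Q z S = firstQueries (B S) (run N z)

    insert-preserves-answers : ∀ {z ℓ S R w} → z ∈ Z → ℓ ∉ₛ S → ℓ ∉ₛ R → w ∈ Q z S →
                               B (R ∪ ⁅ ℓ ⁆) w ≡ B R w
    insert-preserves-answers {z} {ℓ} {S} {R} {w} z∈Z ℓ∉S ℓ∉R w∈Q =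
      let B′ , O+αℓ↦B′ , B′≐B = app-≐-just L (pick-∪⁅⁆ α O R ℓ) (oracle≡B (R ∪ ⁅ ℓ ⁆))
      in  trans (sym (B′≐B w)) (¬Flips⇒agree {L} {O ∪L pick α R} O+αℓ↦B′ (oracle≡B R) no-flip)
      where
      w∈queries : w ∈ queriesOf z (pick α S)
      w∈queries = subst (w ∈_) (cong (maybe′ (λ B → firstQueries B (run N z)) []) (sym (oracle≡B S))) w∈Q
      no-flip : ¬ Flips L (O ∪L pick α R) (α ℓ) w
      no-flip = ⟦⟧≡0⇒¬ (∑≡0⇒≡0 (∑≡0⇒≡0 (∑≡0⇒≡0 (∑≡0⇒≡0 (no-flips ℓ) z∈Z) (∈-avoiding⁺ ℓ∉S))
                                                 (∈-avoiding⁺ ℓ∉R)) w∈queries)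

    answers-agree : ∀ {z S R T w} → z ∈ Z → R ⊆ T → (∀ {j} → j ∈ₛ T → j ∉ₛ R → j ∉ₛ S) → w ∈ Q z S →
                    B T w ≡ B R w
    answers-agree {S = S} {w = w} z∈Z R⊆T new∉S w∈Q =
      insert-invariant (λ R → B R w) (_∉ₛ S) (λ _ j∉R j∉S → insert-preserves-answers z∈Z j∉S j∉R w∈Q) R⊆T new∉S

    consistent-up : ∀ {z} → z ∈ Z → ∀ S R T → R ⊆ T → (∀ {j} → j ∈ₛ T → j ∉ₛ R → j ∉ₛ S) →
               ∀ (P : Path (run N z)) → queries P ≡ Q z S → Consistent (B R) P → Consistent (B T) P
    consistent-up z∈Z S R T R⊆T new∉S P P↦Q c =
      consistent-transfer P c λ w∈ → sym (answers-agree z∈Z R⊆T new∉S (subst (_ ∈_) P↦Q w∈))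

    consistent-down : ∀ {z} → z ∈ Z → ∀ S R T → R ⊆ T → (∀ {j} → j ∈ₛ T → j ∉ₛ R → j ∉ₛ S) →
                ∀ (P : Path (run N z)) → queries P ≡ Q z S → Consistent (B T) P → Consistent (B R) P
    consistent-down z∈Z S R T R⊆T new∉S P P↦Q c =
      consistent-transfer P c λ w∈ → answers-agree z∈Z R⊆T new∉S (subst (_ ∈_) P↦Q w∈)

    two-minimal⇒2≤#acc : ∀ {z S₁ S₂} → z ∈ Z → S₁ ≢ S₂ → MinimalAcc L N O α S₁ z → MinimalAcc L N O α S₂ z →
                   2 ≤ #acc (B (S₁ ∪ S₂)) (run N z)
    two-minimal⇒2≤#acc {z} {S₁} {S₂} z∈Z S₁≢S₂ (acc₁ , min₁) (acc₂ , min₂)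
      with P₁ , c₁ , P₁↦Q ← first-accepting-path (B S₁) (run N z) (Any-≡just⁻ (oracle≡B S₁) acc₁)
         | P₂ , c₂ , P₂↦Q ← first-accepting-path (B S₂) (run N z) (Any-≡just⁻ (oracle≡B S₂) acc₂)
      = two-paths⇒2≤#acc P₁ P₂
          (consistent-up z∈Z S₁ S₁ (S₁ ∪ S₂) (p⊆p∪q S₂) (λ _ j∉S₁ → j∉S₁) P₁ P₁↦Q c₁)
          (consistent-up z∈Z S₂ S₂ (S₁ ∪ S₂) (q⊆p∪q S₁ S₂) (λ _ j∉S₂ → j∉S₂) P₂ P₂↦Q c₂)
          P₁≢P₂
      where
      P₁≢P₂ : P₁ ≢ P₂
      P₁≢P₂ refl = ¬accepts×rejects {N = N}
        (Any-≡just⁺ (oracle≡B (S₁ ∩ S₂)) (consistent⇒accepts P₁ c∩))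
        (min₁ (S₁ ∩ S₂) (⊈⇒∩⊂ (minimal⇒⊈ {N = N} {z} {L} {O} acc₁ (acc₂ , min₂) S₁≢S₂)))
        where
        c∩ : Consistent (B (S₁ ∩ S₂)) P₁
        c∩ = consistent-down z∈Z S₂ (S₁ ∩ S₂) S₁ (p∩q⊆p S₁ S₂)
               (λ j∈S₁ j∉S₁∩S₂ j∈S₂ → j∉S₁∩S₂ (x∈p∩q⁺ (j∈S₁ , j∈S₂))) P₁ P₂↦Q c₁

    accepts-∅ : ∀ {z} → Any (λ B → Accepts N B z) (app L O) → Accepts N (B ∅) z
    accepts-∅ {z} acc =
      let B₀ , O↦B₀ , B₀≐B∅ = app-≐-just L (∪L-pick-∅ α O) (oracle≡B ∅)
      in  subst (1 ≤_) (#acc-cong B₀≐B∅ (run N z)) (Any-≡just⁻ O↦B₀ acc)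

    accept-persists : ∀ {z} → z ∈ Z → Any (λ B → Accepts N B z) (app L O) → ∀ S → Accepts N (B S) z
    accept-persists {z} z∈Z acc S with P , c , P↦Q ← first-accepting-path (B ∅) (run N z) (accepts-∅ acc) =
      consistent⇒accepts P (consistent-up z∈Z ∅ ∅ S ⊥⊆ (λ _ _ → ∉⊥) P P↦Q c)

  good-choice : r * (length Z * (2 ^ r * (2 ^ r * (pm * tpm)))) < n →
    Σ (Vector String r) λ α → α ∈∏ U ×
      (∀ {z} → z ∈ Z → ∀ {S₁ S₂} → S₁ ≢ S₂ → MinimalAcc L N O α S₁ z → MinimalAcc L N O α S₂ z →
         Any (λ B → 2 ≤ #acc B (run N z)) (oracle α (S₁ ∪ S₂))) ×
      (∀ {z} → z ∈ Z → Any (λ B → Accepts N B z) (app L O) → ∀ S → AccWith L N O α S z)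
  good-choice r*c<n =
    let α , α∈U , no-flips = sparse-lines⇒∃-zero U U-length flipsAt _ flipsAt-line r*c<n
        open FlipFree α α∈U no-flips
    in  α , α∈U
      , (λ z∈Z S₁≢S₂ min₁ min₂ → Any-≡just⁺ (oracle≡B _) (two-minimal⇒2≤#acc z∈Z S₁≢S₂ min₁ min₂))
      , (λ z∈Z acc S → Any-≡just⁺ (oracle≡B S) (accept-persists z∈Z acc S))

r*line-bound<u : ∀ (X Y : List String) r a b {u} → (3 * length X + length Y) * r * 2 ^ (2 * r) * a * b < u →
                r * (length (X ++ Y) * (2 ^ r * (2 ^ r * (a * b)))) < u
r*line-bound<u X Y r a b = ≤-<-trans (begin
  r * (length (X ++ Y) * K)     ≡⟨ cong (λ e → r * (e * K)) (length-++ X) ⟩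
  r * ((d + d′) * K)            ≤⟨ *-monoʳ-≤ r (*-monoˡ-≤ K (+-monoˡ-≤ d′ (m≤m+n d _))) ⟩
  r * ((3 * d + d′) * K)        ≡⟨ regroup (3 * d + d′) r (2 ^ r) a b ⟩
  (3 * d + d′) * r * (2 ^ r * 2 ^ r) * a * b
                                ≡⟨ cong (λ k → (3 * d + d′) * r * k * a * b) 2^[2r]≡2^r*2^r ⟨
  (3 * d + d′) * r * 2 ^ (2 * r) * a * b ∎)
  where
  open ≤-Reasoning
  d d′ K : ℕ
  d  = length X
  d′ = length Y
  K  = 2 ^ r * (2 ^ r * (a * b))
  regroup : ∀ e r k a b → r * (e * (k * (k * (a * b)))) ≡ e * r * (k * k) * a * b
  regroup = solve-∀
  2^[2r]≡2^r*2^r : 2 ^ (2 * r) ≡ 2 ^ r * 2 ^ r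
  2^[2r]≡2^r*2^r = trans (^-distribˡ-+-* 2 r (r + 0)) (cong (λ k → 2 ^ r * 2 ^ k) (+-identityʳ r))

lemma4p12 : (h : ℕ) → 1 ≤ h → (t : Poly) → (p : Poly) → (N : NOTM p) →
  (O : StrSet) → (X Y : List String) → (m : ℕ) →
  All (λ x → length x ≤ m) X → All (λ y → length y ≤ m) Y →
  (r : ℕ) → (U : Fin r → List String) → (u : ℕ) →
  (∀ ℓ → Unique (U ℓ)) →
  (∀ ℓ w → w ∈L U ℓ → O w ≡ false) →
  (∀ ℓ ℓ' w → ℓ ≢ ℓ' → w ∈L U ℓ → w ∈L U ℓ' → ⊥) →
  (∀ ℓ ℓ' → length (U ℓ) ≡ length (U ℓ')) →
  (∀ ℓ → u ≤ length (U ℓ)) →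
  (L : SetFun) → Ambiguous h t L →
  (∀ (A : Fin r → List String) → (∀ ℓ → All (λ a → a ∈L U ℓ) (A ℓ)) →
     (∀ ℓ → length (A ℓ) ≤ h) → Is-just (app L (O ∪L ⋃L A))) →
  (3 * length X + length Y) * r * 2 ^ (2 * r) * eval p m * eval t (eval p m) < u →
  Σ (Fin r → String) λ α →
    (∀ ℓ → α ℓ ∈L U ℓ) ×
    (∀ x → x ∈L X → ∀ (S₁ S₂ : Subset r) → Nonempty S₁ → Nonempty S₂ → S₁ ≢ S₂ →
       MinimalAcc L N O α S₁ x → MinimalAcc L N O α S₂ x →
       Any (λ B → 2 ≤ #acc B (run N x)) (app L (O ∪L pick α (S₁ ∪ S₂)))) ×
    (∀ y → y ∈L Y → ∀ (S : Subset r) → Nonempty S →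
       Any (λ B → Accepts N B y) (app L O) → AccWith L N O α S y)
lemma4p12 h 1≤h t p N O X Y m X≤m Y≤m r U u U-unique U∩O≡∅ U-disjoint U-equal u≤U L ambiguous defined bound =
  let n , U-length , u≤n = ∃-common-length U U-equal u≤U
      α , α∈U , minimal-pairs , persists =
        Construction.good-choice 1≤h {t} N O (X ++ Y) (All.++⁺ X≤m Y≤m) U U-length U-unique U∩O≡∅ U-disjoint
          L ambiguous defined (<-≤-trans (r*line-bound<u X Y r _ _ bound) u≤n)
  in  α , α∈U
    , (λ x x∈X S₁ S₂ _ _ S₁≢S₂ → minimal-pairs (∈-++⁺ˡ x∈X) S₁≢S₂)
    , (λ y y∈Y S _ acc → persists (∈-++⁺ʳ X y∈Y) acc S)
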